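{- Let $P=[a_1]\times\cdots\times[a_n]$, let $v=(v_1,\dots,v_n)\in\{\pm1\}^n$, let $\gamma\in\{1,\dots,n\}$, and let $v^*=(v_1,\dots,v_{\gamma-1},v_{\gamma+1},\dots,v_n)$. For $1\le j\le a_\gamma$ let $T^j:J(P)\to J(P)$ be the map that applies the toggles $t_x$ for all $x\in P$ with $x_\gamma=j$, in decreasing order of $\langle x^*,v^*\rangle$, where $x^*$ is $x$ with its $\gamma$-th coordinate deleted (toggles with equal value commute). Then, as maps on $J(P)$: if $v_\gamma=1$, $\mathrm{Pro}_v=T^1\circ T^2\circ\cdots\circ T^{a_\gamma}$ (so the layer $x_\gamma=a_\gamma$ is processed first and the layer $x_\gamma=1$ last); if $v_\gamma=-1$, $\mathrm{Pro}_v=T^{a_\gamma}\circ\cdots\circ T^2\circ T^1$ (so the layer $x_\gamma=1$ is processed first).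
   Context: $[m]=\{1,\dots,m\}$; $P=[a_1]\times\cdots\times[a_n]$ has the componentwise order, elements viewed as vectors in $\mathbb{Z}^n$; $J(P)$ is the set of order ideals of $P$. The toggle $t_e:J(P)\to J(P)$: $t_e(I)=I\cup\{e\}$ if $e\notin I$ and $I\cup\{e\}\in J(P)$; $t_e(I)=I\setminus\{e\}$ if $e\in I$ and $I\setminus\{e\}\in J(P)$; $t_e(I)=I$ otherwise. For $v\in\{\pm1\}^n$, $T^i_v$ is the (commuting) product of the $t_x$ with $\langle x,v\rangle=i$, and $\mathrm{Pro}_v=\cdots T^{ -1}_vT^0_vT^1_v\cdots$, i.e. the $T^i_v$ are applied in decreasing order of $i$. The map $T^j$ in the claim is the toggle product of $\mathrm{Pro}_{v^*}$ on the $j$-th $\gamma$-layer $\{x\in P: x_\gamma=j\}$. -}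

module Defs where

open import Data.Nat as ℕ using (ℕ; zero; suc; pred)
open import Data.Bool using (Bool; true; false; if_then_else_; _∧_; not; _∨_)
open import Data.Fin using (Fin)
open import Data.Vec as Vec using (Vec; []; _∷_; lookup; removeAt; zipWith)
open import Data.List as List using (List; []; _∷_; concatMap; upTo; downFrom; filterᵇ)
open import Data.Sign using (Sign)
open import Data.Integer as ℤ using (ℤ; _◃_; +_; _-_)
open import Data.Vec.Properties using (≡-dec)
open import Relation.Nullary using (does)
open import Function using (id; _∘_)

-- A point of Z^n with natural coordinates (elements of P are those with 1 ≤ x_i ≤ a_i).
Pt : ℕ → Set
Pt n = Vec ℕ n

-- Subsets of P, as characteristic functions (only values on P matter).
Sub : ℕ → Set
Sub n = Pt n → Bool

range1 : ℕ → List ℕ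
range1 m = List.map suc (upTo m)

elemsP : ∀ {n} → Vec ℕ n → List (Pt n)
elemsP []       = [] ∷ []
elemsP (a ∷ as) = concatMap (λ k → List.map (k ∷_) (elemsP as)) (range1 a)

inPᵇ : ∀ {n} → Vec ℕ n → Pt n → Bool
inPᵇ []       []       = true
inPᵇ (a ∷ as) (x ∷ xs) = (1 ℕ.≤ᵇ x) ∧ (x ℕ.≤ᵇ a) ∧ inPᵇ as xs

_≤ᵥ_ : ∀ {n} → Pt n → Pt n → Bool
[]       ≤ᵥ []       = true
(x ∷ xs) ≤ᵥ (y ∷ ys) = (x ℕ.≤ᵇ y) ∧ (xs ≤ᵥ ys)

_⇒ᵇ_ : Bool → Bool → Bool
b ⇒ᵇ c = not b ∨ c

allᵇ : ∀ {A : Set} → (A → Bool) → List A → Bool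
allᵇ p []       = true
allᵇ p (x ∷ xs) = p x ∧ allᵇ p xs

isIdeal : ∀ {n} → Vec ℕ n → Sub n → Bool
isIdeal a I = allᵇ (λ x → allᵇ (λ y → ((y ≤ᵥ x) ∧ I x) ⇒ᵇ I y) (elemsP a)) (elemsP a)

_≟ᵥ_ : ∀ {n} → Pt n → Pt n → Bool
x ≟ᵥ y = does (≡-dec ℕ._≟_ x y)

setAt : ∀ {n} → Sub n → Pt n → Bool → Sub n
setAt I e b y = if y ≟ᵥ e then b else I y

toggle : ∀ {n} → Vec ℕ n → Pt n → Sub n → Sub n
toggle a e I =
  if I e
  then (if isIdeal a (setAt I e false) then setAt I e false else I)
  else (if isIdeal a (setAt I e true) then setAt I e true else I)

-- product of toggles over a list of points (first element applied first)
toggleAll : ∀ {n} → Vec ℕ n → List (Pt n) → Sub n → Sub n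
toggleAll a []       I = I
toggleAll a (e ∷ es) I = toggleAll a es (toggle a e I)

⟨_,_⟩ : ∀ {n} → Pt n → Vec Sign n → ℤ
⟨ x , v ⟩ = Vec.foldr _ ℤ._+_ (+ 0) (zipWith _◃_ v x)

sumV : ∀ {n} → Vec ℕ n → ℕ
sumV = Vec.foldr _ ℕ._+_ 0

-- the integers -S, …, S (increasing), S = a_1 + ⋯ + a_n bounds |⟨x,v⟩| on P
levels : ∀ {n} → Vec ℕ n → List ℤ
levels a = List.map (λ k → (+ k) - (+ sumV a)) (upTo (suc (2 ℕ.* sumV a)))

-- T^i_v : product of t_x over x ∈ P with ⟨x,v⟩ = i (they commute)
Tv : ∀ {n} → Vec ℕ n → Vec Sign n → ℤ → Sub n → Sub n
Tv a v i = toggleAll a (filterᵇ (λ x → does (⟨ x , v ⟩ ℤ.≟ i)) (elemsP a))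

composeL : ∀ {A B : Set} → (B → A → A) → List B → A → A
composeL f = List.foldr (λ b g → f b ∘ g) id

-- Pro_v = ⋯ T^{-1}_v T^0_v T^1_v ⋯ (as composition, T^i with larger i applied first)
Pro : ∀ {n} → Vec ℕ n → Vec Sign n → Sub n → Sub n
Pro a v = composeL (Tv a v) (levels a)

del : ∀ {A : Set} {n} → Vec A n → Fin n → Vec A (pred n)
del {n = suc n} xs γ = removeAt xs γ

Tlayer : ∀ {n} → Vec ℕ n → Vec Sign n → Fin n → ℕ → Sub n → Sub n
Tlayer a v γ j = composeL step (levels a)
  where
  step : ℤ → Sub _ → Sub _
  step k = toggleAll a (filterᵇ (λ x → (lookup x γ ℕ.≡ᵇ j) ∧ does (⟨ del x γ , del v γ ⟩ ℤ.≟ k)) (elemsP a))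

-- Two toggles t_x and t_y commute on J(P) unless x and y form a cover pair. Indeed t_x
-- removes (adds) x exactly when no point strictly above x is in the ideal (all points
-- strictly below x are); if y is comparable with x without being a cover, some point of
-- P lies strictly between them and decides that condition regardless of the value at y,
-- so t_y cannot change what t_x does.  Consequently two orderings of the toggles of all
-- of P induce the same map on J(P) provided every cover pair is toggled in the same
-- relative order by both.  Pro_v toggles the cover pair x ⋖ x + e_i in the order
-- dictated by the sign of v_i, as ⟨x + e_i, v⟩ = ⟨x, v⟩ + v_i.  The layered product
-- agrees: for i ≠ γ both points lie in one layer, which is sorted by ⟨x*, v*⟩ and that
-- rank also moves by v_i; for i = γ the layers are processed from top to bottom exactly
-- when v_γ = 1.

module Submission where

open import Defs
open import Data.Nat as ℕ using (ℕ; suc; _≤ᵇ_; _≡ᵇ_; z≤n; s≤s)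
import Data.Nat.Properties as ℕₚ
open import Data.Bool using (Bool; true; false; if_then_else_; _∧_; not)
open import Data.Bool.Properties using (∧-conicalˡ; ∧-conicalʳ; ∧-zeroʳ; T-≡)
open import Data.Sign as Sign using (Sign)
open import Data.Integer as ℤ using (ℤ; +_; -[1+_]; _◃_)
import Data.Integer.Properties as ℤₚ
open import Algebra.Properties.CommutativeSemigroup ℤₚ.+-commutativeSemigroup using (x∙yz≈y∙xz)
open import Data.Fin using (Fin) renaming (zero to fzero; suc to fsuc)
open import Data.Vec as Vec using (Vec; []; _∷_; lookup)
open import Data.Vec.Properties using (≡-dec)
open import Data.Vec.Relation.Binary.Pointwise.Inductive as Pointwise using (Pointwise; []; _∷_)
open import Data.List as List using (List; []; _∷_; _++_; filterᵇ; reverse)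
open import Data.List.Relation.Unary.Unique.Propositional using (Unique)
import Data.List.Properties as Listₚ
open import Data.List.Membership.Propositional using (_∈_; find; lose)
open import Data.List.Membership.Propositional.Properties
  using (∈-∃++; ∈-++⁺ˡ; ∈-++⁻; ∈-filter⁻; ∈-map⁺; ∈-map⁻; ∈-concatMap⁺; ∈-concatMap⁻;
         ∈-upTo⁺; ∈-upTo⁻)
open import Data.List.Relation.Unary.Any using (here; there)
import Data.List.Relation.Unary.Any.Properties as Any
open import Data.List.Relation.Unary.All as All using (All; []; _∷_)
import Data.List.Relation.Unary.All.Properties as All
open import Data.List.Relation.Unary.AllPairs as AllPairs using (AllPairs; []; _∷_)
import Data.List.Relation.Unary.AllPairs.Properties as AllPairs
open import Data.List.Relation.Binary.Permutation.Propositional using (_↭_; ↭-sym; ↭-trans; ↭-refl; prep)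
open import Data.List.Relation.Binary.Permutation.Propositional.Properties
  using (∈-resp-↭; drop-mid; ↭-empty-inv; shift; ++⁺ʳ; ++⁺)
open import Data.Product using (∃-syntax; _×_; _,_; proj₁; proj₂)
open import Data.Sum using (_⊎_; inj₁; inj₂; [_,_]′; swap)
open import Data.Empty using (⊥-elim)
open import Function using (Equivalence; _∘′_; id)
open import Relation.Nullary using (¬_; Dec; yes; no; does)
open import Relation.Nullary.Decidable.Core using (T?)
open import Relation.Binary.Definitions using (DecidableEquality)
open import Relation.Nullary.Decidable using (dec-true; dec-false)
open import Relation.Binary.PropositionalEquality

∧-intro : ∀ {b c} → b ≡ true → c ≡ true → b ∧ c ≡ true
∧-intro refl refl = refl

∧-elimˡ : ∀ {b c} → b ∧ c ≡ true → b ≡ true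
∧-elimˡ {b} {c} = ∧-conicalˡ b c

∧-elimʳ : ∀ {b c} → b ∧ c ≡ true → c ≡ true
∧-elimʳ {b} {c} = ∧-conicalʳ b c

true≢false : ∀ {b} → b ≡ true → b ≢ false
true≢false refl ()

≡-from-⇔ : ∀ {b c} → (b ≡ true → c ≡ true) → (c ≡ true → b ≡ true) → b ≡ c
≡-from-⇔ {true}           f g = sym (f refl)
≡-from-⇔ {false} {false} f g = refl
≡-from-⇔ {false} {true}  f g = g refl

≤ᵇ-complete : ∀ {m n} → m ℕ.≤ n → (m ≤ᵇ n) ≡ true
≤ᵇ-complete m≤n = Equivalence.to T-≡ (ℕₚ.≤⇒≤ᵇ m≤n)

≤ᵇ-sound : ∀ {m n} → (m ≤ᵇ n) ≡ true → m ℕ.≤ n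
≤ᵇ-sound {m} {n} e = ℕₚ.≤ᵇ⇒≤ m n (Equivalence.from T-≡ e)

allᵇ-elim : ∀ {A : Set} (p : A → Bool) {xs} → allᵇ p xs ≡ true → ∀ {x} → x ∈ xs → p x ≡ true
allᵇ-elim p {x ∷ xs} e (here refl) = ∧-elimˡ e
allᵇ-elim p {x ∷ xs} e (there m)   = allᵇ-elim p (∧-elimʳ {p x} e) m

allᵇ-intro : ∀ {A : Set} (p : A → Bool) xs → (∀ {x} → x ∈ xs → p x ≡ true) → allᵇ p xs ≡ true
allᵇ-intro p []       h = refl
allᵇ-intro p (x ∷ xs) h = ∧-intro (h (here refl)) (allᵇ-intro p xs (h ∘′ there))

allᵇ-cong : ∀ {A : Set} {p q : A → Bool} → p ≗ q → ∀ xs → allᵇ p xs ≡ allᵇ q xs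
allᵇ-cong p≗q []       = refl
allᵇ-cong p≗q (x ∷ xs) = cong₂ _∧_ (p≗q x) (allᵇ-cong p≗q xs)

≟ᵥ-refl : ∀ {n} (x : Pt n) → x ≟ᵥ x ≡ true
≟ᵥ-refl x = dec-true (≡-dec ℕ._≟_ x x) refl

≟ᵥ-≢ : ∀ {n} {x y : Pt n} → x ≢ y → x ≟ᵥ y ≡ false
≟ᵥ-≢ {x = x} {y} = dec-false (≡-dec ℕ._≟_ x y)

setAt-≡ : ∀ {n} (I : Sub n) x b → setAt I x b x ≡ b
setAt-≡ I x b rewrite ≟ᵥ-refl x = refl

setAt-≢ : ∀ {n} (I : Sub n) {x} b {z} → z ≢ x → setAt I x b z ≡ I z
setAt-≢ I b z≢x rewrite ≟ᵥ-≢ z≢x = refl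

-- The poset P and its order ideals

_≤ᵖ_ : ∀ {n} → Pt n → Pt n → Set
_≤ᵖ_ = Pointwise ℕ._≤_

_<ᵖ_ : ∀ {n} → Pt n → Pt n → Set
x <ᵖ y = x ≤ᵖ y × x ≢ y

InP : ∀ {n} → Vec ℕ n → Pt n → Set
InP = Pointwise (λ aᵢ xᵢ → 1 ℕ.≤ xᵢ × xᵢ ℕ.≤ aᵢ)

≤ᵥ⇒≤ᵖ : ∀ {n} {x y : Pt n} → x ≤ᵥ y ≡ true → x ≤ᵖ y
≤ᵥ⇒≤ᵖ {x = []}    {[]}    _ = []
≤ᵥ⇒≤ᵖ {x = x ∷ _} {y ∷ _} e = ≤ᵇ-sound (∧-elimˡ e) ∷ ≤ᵥ⇒≤ᵖ (∧-elimʳ {x ≤ᵇ y} e)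

≤ᵖ⇒≤ᵥ : ∀ {n} {x y : Pt n} → x ≤ᵖ y → x ≤ᵥ y ≡ true
≤ᵖ⇒≤ᵥ []           = refl
≤ᵖ⇒≤ᵥ (x≤y ∷ xs≤ys) = ∧-intro (≤ᵇ-complete x≤y) (≤ᵖ⇒≤ᵥ xs≤ys)

∈elemsP⇒InP : ∀ {n} (a : Vec ℕ n) {x} → x ∈ elemsP a → InP a x
∈elemsP⇒InP []       {[]} _ = []
∈elemsP⇒InP (a ∷ as) x∈ with find (∈-concatMap⁻ (λ k → List.map (k ∷_) (elemsP as)) {xs = range1 a} x∈)
... | k , k∈ , x∈k with ∈-map⁻ (k ∷_) x∈k
... | y , y∈ , refl with ∈-map⁻ suc k∈
... | i , i∈ , refl = (s≤s z≤n , ∈-upTo⁻ i∈) ∷ ∈elemsP⇒InP as y∈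

InP⇒∈elemsP : ∀ {n} (a : Vec ℕ n) {x} → InP a x → x ∈ elemsP a
InP⇒∈elemsP []       []                                = here refl
InP⇒∈elemsP (a ∷ as) ((s≤s {n = i} z≤n , i<a) ∷ xs∈P) =
  ∈-concatMap⁺ (λ k → List.map (k ∷_) (elemsP as)) {xs = range1 a}
    (lose (∈-map⁺ suc (∈-upTo⁺ i<a)) (∈-map⁺ (suc i ∷_) (InP⇒∈elemsP as xs∈P)))

IsIdeal : ∀ {n} → Vec ℕ n → Sub n → Set
IsIdeal a I = ∀ {x y} → InP a x → InP a y → y ≤ᵖ x → I x ≡ true → I y ≡ true

isIdeal⇒IsIdeal : ∀ {n} (a : Vec ℕ n) {I} → isIdeal a I ≡ true → IsIdeal a I
isIdeal⇒IsIdeal a h x∈P y∈P y≤x Ix =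
  ⇒ᵇ-elim (allᵇ-elim _ (allᵇ-elim _ h (InP⇒∈elemsP a x∈P)) (InP⇒∈elemsP a y∈P))
          (∧-intro (≤ᵖ⇒≤ᵥ y≤x) Ix)
  where
  ⇒ᵇ-elim : ∀ {b c} → (b ⇒ᵇ c) ≡ true → b ≡ true → c ≡ true
  ⇒ᵇ-elim e refl = e

IsIdeal⇒isIdeal : ∀ {n} (a : Vec ℕ n) {I} → IsIdeal a I → isIdeal a I ≡ true
IsIdeal⇒isIdeal a h =
  allᵇ-intro _ (elemsP a) λ x∈ → allᵇ-intro _ (elemsP a) λ {y} y∈ →
    ⇒ᵇ-intro λ e → h (∈elemsP⇒InP a x∈) (∈elemsP⇒InP a y∈)
                     (≤ᵥ⇒≤ᵖ (∧-elimˡ e)) (∧-elimʳ {y ≤ᵥ _} e)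
  where
  ⇒ᵇ-intro : ∀ {b c} → (b ≡ true → c ≡ true) → (b ⇒ᵇ c) ≡ true
  ⇒ᵇ-intro {false} h = refl
  ⇒ᵇ-intro {true}  h = h refl

isIdeal-cong : ∀ {n} (a : Vec ℕ n) {I J : Sub n} → I ≗ J → isIdeal a I ≡ isIdeal a J
isIdeal-cong a I≗J =
  allᵇ-cong (λ x → allᵇ-cong (λ y → cong₂ (λ u w → ((y ≤ᵥ x) ∧ u) ⇒ᵇ w) (I≗J x) (I≗J y)) (elemsP a))
            (elemsP a)

setAt-cong : ∀ {n} {I J : Sub n} e b → I ≗ J → setAt I e b ≗ setAt J e b
setAt-cong e b I≗J z = cong (if z ≟ᵥ e then b else_) (I≗J z)

toggledValue : ∀ {n} → Vec ℕ n → Sub n → Pt n → Bool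
toggledValue a I e = if I e then not (isIdeal a (setAt I e false)) else isIdeal a (setAt I e true)

toggle-at : ∀ {n} (a : Vec ℕ n) e I → toggle a e I e ≡ toggledValue a I e
toggle-at a e I with I e in Ie
... | true with isIdeal a (setAt I e false)
...   | true  = setAt-≡ I e false
...   | false = Ie
toggle-at a e I | false with isIdeal a (setAt I e true)
...   | true  = setAt-≡ I e true
...   | false = Ie

toggle-elsewhere : ∀ {n} (a : Vec ℕ n) {e} I {z} → z ≢ e → toggle a e I z ≡ I z
toggle-elsewhere a {e} I z≢e with I e
... | true with isIdeal a (setAt I e false)
...   | true  = setAt-≢ I false z≢e
...   | false = refl
toggle-elsewhere a {e} I z≢e | false with isIdeal a (setAt I e true)
...   | true  = setAt-≢ I true z≢e
...   | false = refl

toggledValue-≡ : ∀ {n} (a : Vec ℕ n) {I J} e → I e ≡ J e →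
  isIdeal a (setAt I e false) ≡ isIdeal a (setAt J e false) →
  isIdeal a (setAt I e true) ≡ isIdeal a (setAt J e true) → toggledValue a I e ≡ toggledValue a J e
toggledValue-≡ a e p q r rewrite p | q | r = refl

toggledValue-cong : ∀ {n} (a : Vec ℕ n) {I J} → I ≗ J → ∀ e → toggledValue a I e ≡ toggledValue a J e
toggledValue-cong a I≗J e =
  toggledValue-≡ a e (I≗J e) (isIdeal-cong a (setAt-cong e false I≗J)) (isIdeal-cong a (setAt-cong e true I≗J))

toggle-cong : ∀ {n} (a : Vec ℕ n) e {I J} → I ≗ J → toggle a e I ≗ toggle a e J
toggle-cong a e {I} {J} I≗J z with ≡-dec ℕ._≟_ z e
... | yes refl = begin
  toggle a z I z       ≡⟨ toggle-at a z I ⟩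
  toggledValue a I z   ≡⟨ toggledValue-cong a I≗J z ⟩
  toggledValue a J z   ≡⟨ toggle-at a z J ⟨
  toggle a z J z       ∎
  where open ≡-Reasoning
... | no z≢e = trans (toggle-elsewhere a I z≢e) (trans (I≗J z) (sym (toggle-elsewhere a J z≢e)))

toggle-isIdeal : ∀ {n} (a : Vec ℕ n) e {I} → isIdeal a I ≡ true → isIdeal a (toggle a e I) ≡ true
toggle-isIdeal a e {I} h with I e
... | true with isIdeal a (setAt I e false) in q
...   | true  = q
...   | false = h
toggle-isIdeal a e {I} h | false with isIdeal a (setAt I e true) in q
...   | true  = q
...   | false = h

toggleAll-cong : ∀ {n} (a : Vec ℕ n) es {I J} → I ≗ J → toggleAll a es I ≗ toggleAll a es J
toggleAll-cong a []       I≗J = I≗J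
toggleAll-cong a (e ∷ es) I≗J = toggleAll-cong a es (toggle-cong a e I≗J)

toggleAll-++ : ∀ {n} (a : Vec ℕ n) es fs I → toggleAll a (es ++ fs) I ≡ toggleAll a fs (toggleAll a es I)
toggleAll-++ a []       fs I = refl
toggleAll-++ a (e ∷ es) fs I = toggleAll-++ a es fs (toggle a e I)

-- Commuting toggles

data _⋖[_]_ : ∀ {n} → Pt n → Fin n → Pt n → Set where
  here  : ∀ {n x} {xs : Pt n} → (x ∷ xs) ⋖[ fzero ] (suc x ∷ xs)
  there : ∀ {n i x} {xs ys : Pt n} → xs ⋖[ i ] ys → (x ∷ xs) ⋖[ fsuc i ] (x ∷ ys)

_⋖_ : ∀ {n} → Pt n → Pt n → Set
x ⋖ y = ∃[ i ] x ⋖[ i ] y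

Adjacent : ∀ {n} → Pt n → Pt n → Set
Adjacent x y = x ⋖ y ⊎ y ⋖ x

⋖⇒<ᵖ : ∀ {n i} {x y : Pt n} → x ⋖[ i ] y → x <ᵖ y
⋖⇒<ᵖ here      = ℕₚ.n≤1+n _ ∷ Pointwise.refl ℕₚ.≤-refl , λ e → ℕₚ.1+n≢n (sym (cong Vec.head e))
⋖⇒<ᵖ (there c) = ℕₚ.≤-refl ∷ proj₁ (⋖⇒<ᵖ c) , λ e → proj₂ (⋖⇒<ᵖ c) (cong Vec.tail e)

Adjacent-irrefl : ∀ {n} {x : Pt n} → ¬ Adjacent x x
Adjacent-irrefl (inj₁ (_ , c)) = proj₂ (⋖⇒<ᵖ c) refl
Adjacent-irrefl (inj₂ (_ , c)) = proj₂ (⋖⇒<ᵖ c) refl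

<ᵖ⇒⋖≤ᵖ : ∀ {n} {x y : Pt n} → x <ᵖ y → ∃[ i ] ∃[ w ] x ⋖[ i ] w × w ≤ᵖ y
<ᵖ⇒⋖≤ᵖ ([]                  , x≢y) = ⊥-elim (x≢y refl)
<ᵖ⇒⋖≤ᵖ (_∷_ {x = x} {y} x≤y xs≤ys , x≢y) with x ℕ.≟ y
... | no  x≢y₀ = fzero , _ , here , ℕₚ.≤∧≢⇒< x≤y x≢y₀ ∷ xs≤ys
... | yes refl with <ᵖ⇒⋖≤ᵖ (xs≤ys , λ e → x≢y (cong (x ∷_) e))
...   | i , w , c , w≤ys = fsuc i , x ∷ w , there c , ℕₚ.≤-refl ∷ w≤ys

InP-between : ∀ {n} {a : Vec ℕ n} {x w y} → InP a x → InP a y → x ≤ᵖ w → w ≤ᵖ y → InP a w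
InP-between []                       []                        []             []             = []
InP-between ((1≤x , _) ∷ xs∈P) ((_ , y≤a) ∷ ys∈P) (x≤w ∷ xs≤ws) (w≤y ∷ ws≤ys) =
  (ℕₚ.≤-trans 1≤x x≤w , ℕₚ.≤-trans w≤y y≤a) ∷ InP-between xs∈P ys∈P xs≤ws ws≤ys

between : ∀ {n} {a : Vec ℕ n} {x y} → InP a x → InP a y → x <ᵖ y → ¬ x ⋖ y →
  ∃[ w ] InP a w × x <ᵖ w × w <ᵖ y
between x∈P y∈P x<y x⋖̸y with <ᵖ⇒⋖≤ᵖ x<y
... | i , w , c , w≤y =
  w , InP-between x∈P y∈P (proj₁ (⋖⇒<ᵖ c)) w≤y , ⋖⇒<ᵖ c , (w≤y , λ { refl → x⋖̸y (i , c) })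

⋖-lookup : ∀ {n i} {x y : Pt n} → x ⋖[ i ] y → ∀ γ →
  (i ≡ γ × lookup y γ ≡ suc (lookup x γ)) ⊎ lookup y γ ≡ lookup x γ
⋖-lookup here      fzero    = inj₁ (refl , refl)
⋖-lookup here      (fsuc γ) = inj₂ refl
⋖-lookup (there c) fzero    = inj₂ refl
⋖-lookup (there c) (fsuc γ) with ⋖-lookup c γ
... | inj₁ (refl , e) = inj₁ (refl , e)
... | inj₂ e          = inj₂ e

NothingAbove : ∀ {n} → Vec ℕ n → Sub n → Pt n → Set
NothingAbove a I x = ∀ {z} → InP a z → x <ᵖ z → I z ≡ false

AllBelow : ∀ {n} → Vec ℕ n → Sub n → Pt n → Set
AllBelow a I x = ∀ {z} → InP a z → z <ᵖ x → I z ≡ true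

removable⇒NothingAbove : ∀ {n} (a : Vec ℕ n) {I x} → InP a x →
  isIdeal a (setAt I x false) ≡ true → NothingAbove a I x
removable⇒NothingAbove a {I} {x} x∈P h {z} z∈P (x≤z , x≢z) with I z in Iz
... | false = refl
... | true  = ⊥-elim (true≢false
  (isIdeal⇒IsIdeal a h z∈P x∈P x≤z (trans (setAt-≢ I false (x≢z ∘′ sym)) Iz)) (setAt-≡ I x false))

NothingAbove⇒removable : ∀ {n} (a : Vec ℕ n) {I x} → IsIdeal a I →
  NothingAbove a I x → isIdeal a (setAt I x false) ≡ true
NothingAbove⇒removable a {I} {x} ideal above = IsIdeal⇒isIdeal a λ {p} {q} p∈P q∈P q≤p Jp →
  check p∈P q∈P q≤p Jp (≡-dec ℕ._≟_ p x) (≡-dec ℕ._≟_ q x)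
  where
  check : ∀ {p q} → InP a p → InP a q → q ≤ᵖ p → setAt I x false p ≡ true →
    Dec (p ≡ x) → Dec (q ≡ x) → setAt I x false q ≡ true
  check _ _ _ Jp (yes refl) _ = ⊥-elim (true≢false Jp (setAt-≡ I x false))
  check p∈P _ q≤p Jp (no p≢x) (yes refl) =
    ⊥-elim (true≢false (trans (sym (setAt-≢ I false p≢x)) Jp) (above p∈P (q≤p , p≢x ∘′ sym)))
  check p∈P q∈P q≤p Jp (no p≢x) (no q≢x) =
    trans (setAt-≢ I false q≢x) (ideal p∈P q∈P q≤p (trans (sym (setAt-≢ I false p≢x)) Jp))

addable⇒AllBelow : ∀ {n} (a : Vec ℕ n) {I x} → InP a x →
  isIdeal a (setAt I x true) ≡ true → AllBelow a I x
addable⇒AllBelow a {I} {x} x∈P h z∈P (z≤x , z≢x) =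
  trans (sym (setAt-≢ I true z≢x)) (isIdeal⇒IsIdeal a h x∈P z∈P z≤x (setAt-≡ I x true))

AllBelow⇒addable : ∀ {n} (a : Vec ℕ n) {I x} → IsIdeal a I →
  AllBelow a I x → isIdeal a (setAt I x true) ≡ true
AllBelow⇒addable a {I} {x} ideal below = IsIdeal⇒isIdeal a λ {p} {q} p∈P q∈P q≤p Jp →
  check p∈P q∈P q≤p Jp (≡-dec ℕ._≟_ p x) (≡-dec ℕ._≟_ q x)
  where
  check : ∀ {p q} → InP a p → InP a q → q ≤ᵖ p → setAt I x true p ≡ true →
    Dec (p ≡ x) → Dec (q ≡ x) → setAt I x true q ≡ true
  check _ _ _ _ _ (yes refl) = setAt-≡ I x true
  check _ q∈P q≤p _ (yes refl) (no q≢x) = trans (setAt-≢ I true q≢x) (below q∈P (q≤p , q≢x))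
  check p∈P q∈P q≤p Jp (no p≢x) (no q≢x) =
    trans (setAt-≢ I true q≢x) (ideal p∈P q∈P q≤p (trans (sym (setAt-≢ I true p≢x)) Jp))

NothingAbove-transfer : ∀ {n} (a : Vec ℕ n) {I J x y} → IsIdeal a J → InP a x → InP a y → ¬ x ⋖ y →
  (∀ {z} → z ≢ y → J z ≡ I z) → NothingAbove a I x → NothingAbove a J x
NothingAbove-transfer a {I} {J} {x} {y} idealJ x∈P y∈P x⋖̸y agree above {z} z∈P x<z
  with ≡-dec ℕ._≟_ z y
... | no z≢y   = trans (agree z≢y) (above z∈P x<z)
... | yes refl with between x∈P z∈P x<z x⋖̸y | J z in Jz
...   | _ , _   , _   , _            | false = refl
...   | w , w∈P , x<w , (w≤z , w≢z) | true  =
  ⊥-elim (true≢false (trans (sym (agree w≢z)) (idealJ z∈P w∈P w≤z Jz)) (above w∈P x<w))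

AllBelow-transfer : ∀ {n} (a : Vec ℕ n) {I J x y} → IsIdeal a J → InP a x → InP a y → ¬ y ⋖ x →
  (∀ {z} → z ≢ y → J z ≡ I z) → AllBelow a I x → AllBelow a J x
AllBelow-transfer a {I} {J} {x} {y} idealJ x∈P y∈P y⋖̸x agree below {z} z∈P z<x
  with ≡-dec ℕ._≟_ z y
... | no z≢y   = trans (agree z≢y) (below z∈P z<x)
... | yes refl with between z∈P x∈P z<x y⋖̸x
...   | w , w∈P , (z≤w , z≢w) , w<x =
  idealJ w∈P z∈P z≤w (trans (agree (z≢w ∘′ sym)) (below w∈P w<x))

toggledValue-toggle : ∀ {n} (a : Vec ℕ n) {I x y} → isIdeal a I ≡ true → InP a x → InP a y → x ≢ y →
  ¬ Adjacent x y → toggledValue a (toggle a y I) x ≡ toggledValue a I x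
toggledValue-toggle a {I} {x} {y} hI x∈P y∈P x≢y nonadj =
  toggledValue-≡ a x (toggle-elsewhere a I x≢y) removable-eq addable-eq
  where
  I′ : Sub _
  I′ = toggle a y I
  idealI : IsIdeal a I
  idealI = isIdeal⇒IsIdeal a hI
  idealI′ : IsIdeal a I′
  idealI′ = isIdeal⇒IsIdeal a (toggle-isIdeal a y hI)
  I′≈I : ∀ {z} → z ≢ y → I′ z ≡ I z
  I′≈I = toggle-elsewhere a I
  I≈I′ : ∀ {z} → z ≢ y → I z ≡ I′ z
  I≈I′ z≢y = sym (I′≈I z≢y)
  x⋖̸y : ¬ x ⋖ y
  x⋖̸y = nonadj ∘′ inj₁
  y⋖̸x : ¬ y ⋖ x
  y⋖̸x = nonadj ∘′ inj₂
  removable-eq : isIdeal a (setAt I′ x false) ≡ isIdeal a (setAt I x false)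
  removable-eq = ≡-from-⇔
    (λ h → NothingAbove⇒removable a idealI
             (NothingAbove-transfer a idealI x∈P y∈P x⋖̸y I≈I′ (removable⇒NothingAbove a x∈P h)))
    (λ h → NothingAbove⇒removable a idealI′
             (NothingAbove-transfer a idealI′ x∈P y∈P x⋖̸y I′≈I (removable⇒NothingAbove a x∈P h)))
  addable-eq : isIdeal a (setAt I′ x true) ≡ isIdeal a (setAt I x true)
  addable-eq = ≡-from-⇔
    (λ h → AllBelow⇒addable a idealI
             (AllBelow-transfer a idealI x∈P y∈P y⋖̸x I≈I′ (addable⇒AllBelow a x∈P h)))
    (λ h → AllBelow⇒addable a idealI′
             (AllBelow-transfer a idealI′ x∈P y∈P y⋖̸x I′≈I (addable⇒AllBelow a x∈P h)))

toggle-comm : ∀ {n} (a : Vec ℕ n) {I x y} → isIdeal a I ≡ true → InP a x → InP a y →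
  ¬ Adjacent x y → toggle a x (toggle a y I) ≗ toggle a y (toggle a x I)
toggle-comm a {I} {x} {y} hI x∈P y∈P nonadj z with ≡-dec ℕ._≟_ x y
... | yes refl = refl
... | no x≢y with ≡-dec ℕ._≟_ z x | ≡-dec ℕ._≟_ z y
...   | yes refl | _ = begin
  toggle a z (toggle a y I) z    ≡⟨ toggle-at a z (toggle a y I) ⟩
  toggledValue a (toggle a y I) z ≡⟨ toggledValue-toggle a hI x∈P y∈P x≢y nonadj ⟩
  toggledValue a I z             ≡⟨ toggle-at a z I ⟨
  toggle a z I z                 ≡⟨ toggle-elsewhere a (toggle a z I) x≢y ⟨
  toggle a y (toggle a z I) z    ∎
  where open ≡-Reasoning
...   | no _ | yes refl = begin
  toggle a x (toggle a z I) z    ≡⟨ toggle-elsewhere a (toggle a z I) (x≢y ∘′ sym) ⟩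
  toggle a z I z                 ≡⟨ toggle-at a z I ⟩
  toggledValue a I z             ≡⟨ toggledValue-toggle a hI y∈P x∈P (x≢y ∘′ sym) (nonadj ∘′ swap) ⟨
  toggledValue a (toggle a x I) z ≡⟨ toggle-at a z (toggle a x I) ⟨
  toggle a z (toggle a x I) z    ∎
  where open ≡-Reasoning
...   | no z≢x | no z≢y = begin
  toggle a x (toggle a y I) z    ≡⟨ toggle-elsewhere a (toggle a y I) z≢x ⟩
  toggle a y I z                 ≡⟨ toggle-elsewhere a I z≢y ⟩
  I z                            ≡⟨ toggle-elsewhere a I z≢x ⟨
  toggle a x I z                 ≡⟨ toggle-elsewhere a (toggle a x I) z≢y ⟨
  toggle a y (toggle a x I) z    ∎
  where open ≡-Reasoning

-- Reordering toggle sequences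

AllPairs-++⁻ : ∀ {A : Set} {R : A → A → Set} xs {ys} → AllPairs R (xs ++ ys) →
  AllPairs R xs × AllPairs R ys × All (λ x → All (R x) ys) xs
AllPairs-++⁻ []       h       = [] , h , []
AllPairs-++⁻ (x ∷ xs) (r ∷ h) with AllPairs-++⁻ xs h
... | p , q , c = All.++⁻ˡ xs r ∷ p , q , All.++⁻ʳ xs r ∷ c

AllPairs-drop-mid : ∀ {A : Set} {R : A → A → Set} xs {y ys} → AllPairs R (xs ++ y ∷ ys) → AllPairs R (xs ++ ys)
AllPairs-drop-mid xs h with AllPairs-++⁻ xs h
... | p , _ ∷ q , c = AllPairs.++⁺ p q (All.map All.tail c)

AllPairs-before-mid : ∀ {A : Set} {R : A → A → Set} xs {y ys} → AllPairs R (xs ++ y ∷ ys) → All (λ x → R x y) xs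
AllPairs-before-mid xs h = All.map All.head (proj₂ (proj₂ (AllPairs-++⁻ xs h)))

module Reordering {n} (a : Vec ℕ n) (_◁_ : Pt n → Pt n → Set)
  (orient : ∀ {x y} → Adjacent x y → x ◁ y ⊎ y ◁ x) where

  Respects : List (Pt n) → Set
  Respects = AllPairs (λ x y → ¬ y ◁ x)

  toggle-past : ∀ {e} ys {I} → All (λ y → ¬ Adjacent e y) ys → All (InP a) ys → InP a e →
    isIdeal a I ≡ true → toggle a e (toggleAll a ys I) ≗ toggleAll a ys (toggle a e I)
  toggle-past []       _                _              _   _  _ = refl
  toggle-past (y ∷ ys) {I} (e≁y ∷ e≁ys) (y∈P ∷ ys∈P) e∈P hI z =
    trans (toggle-past ys e≁ys ys∈P e∈P (toggle-isIdeal a y hI) z)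
          (toggleAll-cong a ys (toggle-comm a hI e∈P y∈P e≁y) z)

  toggleAll-pull : ∀ {e} pre post {I} → All (λ y → ¬ Adjacent e y) pre → All (InP a) pre → InP a e →
    isIdeal a I ≡ true → toggleAll a (pre ++ e ∷ post) I ≗ toggleAll a (pre ++ post) (toggle a e I)
  toggleAll-pull {e} pre post {I} e≁pre pre∈P e∈P hI z = begin
    toggleAll a (pre ++ e ∷ post) I z
      ≡⟨ cong (λ J → J z) (toggleAll-++ a pre (e ∷ post) I) ⟩
    toggleAll a post (toggle a e (toggleAll a pre I)) z
      ≡⟨ toggleAll-cong a post (toggle-past pre e≁pre pre∈P e∈P hI) z ⟩
    toggleAll a post (toggleAll a pre (toggle a e I)) z
      ≡⟨ cong (λ J → J z) (toggleAll-++ a pre post (toggle a e I)) ⟨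
    toggleAll a (pre ++ post) (toggle a e I) z
      ∎
    where open ≡-Reasoning

  toggleAll-reorder : ∀ {L} L′ → L ↭ L′ → All (InP a) L → Respects L → Respects L′ →
    ∀ {I} → isIdeal a I ≡ true → toggleAll a L I ≗ toggleAll a L′ I
  toggleAll-reorder [] L↭[] _ _ _ hI z rewrite ↭-empty-inv L↭[] = refl
  toggleAll-reorder (e ∷ rest) L↭ L∈P respL (e◁̸rest ∷ respRest) hI z
    with ∈-∃++ (∈-resp-↭ (↭-sym L↭) (here refl))
  ... | pre , post , refl =
    trans (toggleAll-pull pre post e≁pre pre∈P (All.head post∈P) hI z)
          (toggleAll-reorder rest (drop-mid pre [] L↭) (All.++⁺ pre∈P (All.tail post∈P))
                             (AllPairs-drop-mid pre respL) respRest (toggle-isIdeal a e hI) z)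
    where
    pre∈P : All (InP a) pre
    pre∈P = All.++⁻ˡ pre L∈P
    post∈P : All (InP a) (e ∷ post)
    post∈P = All.++⁻ʳ pre L∈P
    -- e follows pre in L but precedes it in L′, so no y in pre may be ordered against e.
    e≁pre : All (λ y → ¬ Adjacent e y) pre
    e≁pre = All.tabulate λ y∈pre adj →
      [ All.lookup (AllPairs-before-mid pre respL) y∈pre , y◁̸e y∈pre adj ]′ (orient adj)
      where
      y◁̸e : ∀ {y} → y ∈ pre → Adjacent e y → ¬ y ◁ e
      y◁̸e y∈pre adj with ∈-resp-↭ L↭ (∈-++⁺ˡ y∈pre)
      ... | here refl    = ⊥-elim (Adjacent-irrefl adj)
      ... | there y∈rest = All.lookup e◁̸rest y∈rest

-- Bucketing a list by keys

revConcatMap : ∀ {A B : Set} → (B → List A) → List B → List A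
revConcatMap f []       = []
revConcatMap f (b ∷ bs) = revConcatMap f bs ++ f b

revConcatMap-[] : ∀ {A B : Set} (bs : List B) → revConcatMap {A} (λ _ → []) bs ≡ []
revConcatMap-[] []       = refl
revConcatMap-[] (b ∷ bs) = trans (Listₚ.++-identityʳ _) (revConcatMap-[] bs)

revConcatMap-cong : ∀ {A B : Set} {f g : B → List A} → f ≗ g → revConcatMap f ≗ revConcatMap g
revConcatMap-cong f≗g []       = refl
revConcatMap-cong f≗g (b ∷ bs) = cong₂ _++_ (revConcatMap-cong f≗g bs) (f≗g b)

∈-revConcatMap⁻ : ∀ {A B : Set} (f : B → List A) bs {x} → x ∈ revConcatMap f bs → ∃[ b ] b ∈ bs × x ∈ f b
∈-revConcatMap⁻ f (b ∷ bs) x∈ with ∈-++⁻ (revConcatMap f bs) x∈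
... | inj₁ x∈bs = let (c , c∈ , x∈c) = ∈-revConcatMap⁻ f bs x∈bs in c , there c∈ , x∈c
... | inj₂ x∈b  = b , here refl , x∈b

revConcatMap-↭ : ∀ {A B : Set} {f g : B → List A} → (∀ b → f b ↭ g b) →
  ∀ bs → revConcatMap f bs ↭ revConcatMap g bs
revConcatMap-↭ f↭g []       = ↭-refl
revConcatMap-↭ f↭g (b ∷ bs) = ++⁺ (revConcatMap-↭ f↭g bs) (f↭g b)

filterᵇ-true : ∀ {A : Set} (xs : List A) → filterᵇ (λ _ → true) xs ≡ xs
filterᵇ-true []       = refl
filterᵇ-true (x ∷ xs) = cong (x ∷_) (filterᵇ-true xs)

AllPairs-tabulate : ∀ {A : Set} {R : A → A → Set} xs → (∀ {x y} → x ∈ xs → y ∈ xs → R x y) → AllPairs R xs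
AllPairs-tabulate []       h = []
AllPairs-tabulate (x ∷ xs) h =
  All.tabulate (h (here refl) ∘′ there) ∷ AllPairs-tabulate xs (λ p q → h (there p) (there q))

-- Later blocks come first, so an S-sorted key list puts its S-larger blocks in front.
revConcatMap-AllPairs : ∀ {A B : Set} {R : A → A → Set} {S : B → B → Set} (f : B → List A) {bs} →
  AllPairs S bs → (∀ b → AllPairs R (f b)) →
  (∀ {b c} → S b c → ∀ {x y} → x ∈ f c → y ∈ f b → R x y) → AllPairs R (revConcatMap f bs)
revConcatMap-AllPairs f []            _      _     = []
revConcatMap-AllPairs f {b ∷ bs} (b<bs ∷ sorted) blocks cross =
  AllPairs.++⁺ (revConcatMap-AllPairs f sorted blocks cross) (blocks b)
    (All.tabulate λ x∈ → let (c , c∈ , x∈c) = ∈-revConcatMap⁻ f bs x∈ in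
      All.tabulate λ y∈b → cross (All.lookup b<bs c∈) x∈c y∈b)

filterᵇ-accept : ∀ {A : Set} (p : A → Bool) {x xs} → p x ≡ true → filterᵇ p (x ∷ xs) ≡ x ∷ filterᵇ p xs
filterᵇ-accept p px rewrite px = refl

filterᵇ-reject : ∀ {A : Set} (p : A → Bool) {x xs} → p x ≡ false → filterᵇ p (x ∷ xs) ≡ filterᵇ p xs
filterᵇ-reject p px rewrite px = refl

composeL-toggleAll : ∀ {n} (a : Vec ℕ n) {B : Set} (f : B → List (Pt n)) bs I →
  composeL (λ b → toggleAll a (f b)) bs I ≡ toggleAll a (revConcatMap f bs) I
composeL-toggleAll a f []       I = refl
composeL-toggleAll a f (b ∷ bs) I =
  trans (cong (toggleAll a (f b)) (composeL-toggleAll a f bs I)) (sym (toggleAll-++ a (revConcatMap f bs) (f b) I))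

composeL-cong : ∀ {A B : Set} {f g : B → A → A} → (∀ b → f b ≗ g b) → ∀ bs → composeL f bs ≗ composeL g bs
composeL-cong f≗g []       I = refl
composeL-cong {f = f} f≗g (b ∷ bs) I = trans (cong (f b) (composeL-cong f≗g bs I)) (f≗g b _)

module Buckets {A K : Set} (_≟_ : DecidableEquality K) where

  bucket : (A → Bool) → (A → K) → List A → K → List A
  bucket Q κ xs k = filterᵇ (λ x → Q x ∧ does (κ x ≟ k)) xs

  ∈-bucket⁻ : ∀ Q κ xs {k x} → x ∈ bucket Q κ xs k → x ∈ xs × Q x ≡ true × κ x ≡ k
  ∈-bucket⁻ Q κ xs {k} {x} x∈ with ∈-filter⁻ (λ y → T? (Q y ∧ does (κ y ≟ k))) {xs = xs} x∈
  ... | x∈xs , px with Q x | κ x ≟ k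
  ...   | true | yes κx≡k = x∈xs , refl , κx≡k

  module _ (Q : A → Bool) (κ : A → K) where

    bucket-skip : ∀ {x} xs {k} → κ x ≢ k → bucket Q κ (x ∷ xs) k ≡ bucket Q κ xs k
    bucket-skip {x} xs {k} κx≢k =
      filterᵇ-reject (λ y → Q y ∧ does (κ y ≟ k))
        (trans (cong (Q x ∧_) (dec-false (κ x ≟ k) κx≢k)) (∧-zeroʳ (Q x)))

    revConcatMap-bucket-skip : ∀ {x} xs {ks} → All (κ x ≢_) ks →
      revConcatMap (bucket Q κ (x ∷ xs)) ks ≡ revConcatMap (bucket Q κ xs) ks
    revConcatMap-bucket-skip xs []             = refl
    revConcatMap-bucket-skip xs (κx≢k ∷ κx∉ks) =
      cong₂ _++_ (revConcatMap-bucket-skip xs κx∉ks) (bucket-skip xs κx≢k)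

    revConcatMap-bucket-insert : ∀ {x} xs {ks} → Q x ≡ true → Unique ks → κ x ∈ ks →
      revConcatMap (bucket Q κ (x ∷ xs)) ks ↭ x ∷ revConcatMap (bucket Q κ xs) ks
    revConcatMap-bucket-insert {x} xs {k ∷ ks} Qx (k∉ks ∷ _) (here refl)
      rewrite revConcatMap-bucket-skip xs k∉ks
            | filterᵇ-accept (λ y → Q y ∧ does (κ y ≟ κ x)) {x} {xs}
                (cong₂ _∧_ Qx (dec-true (κ x ≟ κ x) refl)) =
      shift x (revConcatMap (bucket Q κ xs) ks) (bucket Q κ xs (κ x))
    revConcatMap-bucket-insert {x} xs {k ∷ ks} Qx (k∉ks ∷ uniq) (there κx∈ks)
      rewrite bucket-skip {x} xs {k} (λ κx≡k → All.lookup k∉ks κx∈ks (sym κx≡k)) =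
      ++⁺ʳ (bucket Q κ xs k) (revConcatMap-bucket-insert xs Qx uniq κx∈ks)

    revConcatMap-bucket-↭ : ∀ xs {ks} → Unique ks → (∀ {x} → x ∈ xs → Q x ≡ true → κ x ∈ ks) →
      revConcatMap (bucket Q κ xs) ks ↭ filterᵇ Q xs
    revConcatMap-bucket-↭ []       {ks} _ _ rewrite revConcatMap-[] {A} ks = ↭-refl
    revConcatMap-bucket-↭ (x ∷ xs) {ks} uniq caught = by-Q (Q x) refl
      where
      rest : revConcatMap (bucket Q κ xs) ks ↭ filterᵇ Q xs
      rest = revConcatMap-bucket-↭ xs uniq (caught ∘′ there)
      by-Q : ∀ b → Q x ≡ b → revConcatMap (bucket Q κ (x ∷ xs)) ks ↭ filterᵇ Q (x ∷ xs)
      by-Q true Qx rewrite filterᵇ-accept Q {x} {xs} Qx =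
        ↭-trans (revConcatMap-bucket-insert xs Qx uniq (caught (here refl) Qx)) (prep x rest)
      by-Q false Qx rewrite filterᵇ-reject Q {x} {xs} Qx
                          | revConcatMap-cong (λ k → filterᵇ-reject (λ y → Q y ∧ does (κ y ≟ k)) {x} {xs}
                                                        (cong (_∧ does (κ x ≟ k)) Qx)) ks = rest

module _ {A : Set} where
  open Buckets {A} ℤ._≟_

  revConcatMap-bucket-sorted : ∀ Q κ xs {ks} → AllPairs ℤ._<_ ks →
    AllPairs (λ x y → κ y ℤ.≤ κ x) (revConcatMap (bucket Q κ xs) ks)
  revConcatMap-bucket-sorted Q κ xs sorted = revConcatMap-AllPairs (bucket Q κ xs) sorted
    (λ k → AllPairs-tabulate _ λ x∈ y∈ → ℤₚ.≤-reflexive (trans (key y∈) (sym (key x∈))))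
    (λ k<k′ x∈ y∈ → subst₂ ℤ._≤_ (sym (key y∈)) (sym (key x∈)) (ℤₚ.<⇒≤ k<k′))
    where
    key : ∀ {k x} → x ∈ bucket Q κ xs k → κ x ≡ k
    key x∈ = proj₂ (proj₂ (∈-bucket⁻ Q κ xs x∈))

+1-step : ∀ i → i ℤ.< (Sign.+ ◃ 1) ℤ.+ i
+1-step i = ℤₚ.i≤pred[j]⇒i<j (ℤₚ.≤-reflexive (sym (ℤₚ.pred-suc i)))

-1-step : ∀ i → (Sign.- ◃ 1) ℤ.+ i ℤ.< i
-1-step i = ℤₚ.i≤pred[j]⇒i<j ℤₚ.≤-refl

◃1-step : ∀ s i → i ℤ.< (s ◃ 1) ℤ.+ i ⊎ (s ◃ 1) ℤ.+ i ℤ.< i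
◃1-step Sign.+ i = inj₁ (+1-step i)
◃1-step Sign.- i = inj₂ (-1-step i)

⟨⟩-⋖ : ∀ {n i} {x y : Pt n} (v : Vec Sign n) → x ⋖[ i ] y → ⟨ y , v ⟩ ≡ (lookup v i ◃ 1) ℤ.+ ⟨ x , v ⟩
⟨⟩-⋖ (s ∷ vs) (here {x = x} {xs}) = begin
  (s ◃ suc x) ℤ.+ ⟨ xs , vs ⟩               ≡⟨ cong (ℤ._+ ⟨ xs , vs ⟩) (ℤₚ.◃-distrib-+ s 1 x) ⟩
  ((s ◃ 1) ℤ.+ (s ◃ x)) ℤ.+ ⟨ xs , vs ⟩     ≡⟨ ℤₚ.+-assoc (s ◃ 1) (s ◃ x) ⟨ xs , vs ⟩ ⟩
  (s ◃ 1) ℤ.+ ((s ◃ x) ℤ.+ ⟨ xs , vs ⟩)     ∎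
  where open ≡-Reasoning
⟨⟩-⋖ (s ∷ vs) (there {i = i} {x} {xs} c) = begin
  (s ◃ x) ℤ.+ ⟨ _ , vs ⟩                       ≡⟨ cong (λ r → (s ◃ x) ℤ.+ r) (⟨⟩-⋖ vs c) ⟩
  (s ◃ x) ℤ.+ ((lookup vs i ◃ 1) ℤ.+ ⟨ xs , vs ⟩) ≡⟨ x∙yz≈y∙xz (s ◃ x) (lookup vs i ◃ 1) ⟨ xs , vs ⟩ ⟩
  (lookup vs i ◃ 1) ℤ.+ ((s ◃ x) ℤ.+ ⟨ xs , vs ⟩) ∎
  where open ≡-Reasoning

⟨⟩-del : ∀ {n} (x : Pt n) (v : Vec Sign n) γ →
  ⟨ x , v ⟩ ≡ (lookup v γ ◃ lookup x γ) ℤ.+ ⟨ del x γ , del v γ ⟩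
⟨⟩-del (x ∷ xs)     (s ∷ vs)     fzero    = refl
⟨⟩-del (x ∷ y ∷ xs) (s ∷ t ∷ vs) (fsuc γ) =
  trans (cong (λ r → (s ◃ x) ℤ.+ r) (⟨⟩-del (y ∷ xs) (t ∷ vs) γ))
        (x∙yz≈y∙xz (s ◃ x) (lookup (t ∷ vs) γ ◃ lookup (y ∷ xs) γ) ⟨ del (y ∷ xs) γ , del (t ∷ vs) γ ⟩)

∣⟨⟩∣≤sumV : ∀ {n} (x : Pt n) (v : Vec Sign n) → ℤ.∣ ⟨ x , v ⟩ ∣ ℕ.≤ sumV x
∣⟨⟩∣≤sumV []       []       = z≤n
∣⟨⟩∣≤sumV (x ∷ xs) (s ∷ vs) = begin
  ℤ.∣ (s ◃ x) ℤ.+ ⟨ xs , vs ⟩ ∣          ≤⟨ ℤₚ.∣i+j∣≤∣i∣+∣j∣ (s ◃ x) ⟨ xs , vs ⟩ ⟩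
  ℤ.∣ s ◃ x ∣ ℕ.+ ℤ.∣ ⟨ xs , vs ⟩ ∣      ≡⟨ cong (ℕ._+ ℤ.∣ ⟨ xs , vs ⟩ ∣) (ℤₚ.abs-◃ s x) ⟩
  x ℕ.+ ℤ.∣ ⟨ xs , vs ⟩ ∣                ≤⟨ ℕₚ.+-monoʳ-≤ x (∣⟨⟩∣≤sumV xs vs) ⟩
  x ℕ.+ sumV xs                          ∎
  where open ℕₚ.≤-Reasoning

sumV-del : ∀ {n} (x : Pt n) γ → sumV (del x γ) ℕ.≤ sumV x
sumV-del (x ∷ xs)     fzero    = ℕₚ.m≤n+m (sumV xs) x
sumV-del (x ∷ y ∷ xs) (fsuc γ) = ℕₚ.+-monoʳ-≤ x (sumV-del (y ∷ xs) γ)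

InP⇒sumV≤ : ∀ {n} {a x : Vec ℕ n} → InP a x → sumV x ℕ.≤ sumV a
InP⇒sumV≤ []                   = z≤n
InP⇒sumV≤ ((_ , x≤a) ∷ xs∈P) = ℕₚ.+-mono-≤ x≤a (InP⇒sumV≤ xs∈P)

∣∣≤⇒∈levels : ∀ {n} (a : Vec ℕ n) i → ℤ.∣ i ∣ ℕ.≤ sumV a → i ∈ levels a
∣∣≤⇒∈levels a (+ m) m≤S = subst (_∈ levels a) shifted (level (m ℕ.+ S) (ℕₚ.+-monoˡ-≤ S m≤S))
  where
  S : ℕ
  S = sumV a
  shifted : + (m ℕ.+ S) ℤ.- + S ≡ + m
  shifted = begin
    + (m ℕ.+ S) ℤ.- + S   ≡⟨ ℤₚ.[+m]-[+n]≡m⊖n (m ℕ.+ S) S ⟩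
    (m ℕ.+ S) ℤ.⊖ S       ≡⟨ ℤₚ.⊖-≥ (ℕₚ.m≤n+m S m) ⟩
    + (m ℕ.+ S ℕ.∸ S)     ≡⟨ cong +_ (ℕₚ.m+n∸n≡m m S) ⟩
    + m                   ∎
    where open ≡-Reasoning
  level : ∀ k → k ℕ.≤ S ℕ.+ S → + k ℤ.- + S ∈ levels a
  level k k≤ = ∈-map⁺ _ (∈-upTo⁺ (s≤s (subst (k ℕ.≤_) (cong (S ℕ.+_) (sym (ℕₚ.+-identityʳ S))) k≤)))
∣∣≤⇒∈levels a -[1+ m ] m<S = subst (_∈ levels a) shifted
  (∈-map⁺ _ (∈-upTo⁺ (s≤s (ℕₚ.≤-trans (ℕₚ.m∸n≤m S (suc m)) (ℕₚ.m≤m+n S _)))))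
  where
  S : ℕ
  S = sumV a
  shifted : + (S ℕ.∸ suc m) ℤ.- + S ≡ -[1+ m ]
  shifted = begin
    + (S ℕ.∸ suc m) ℤ.- + S       ≡⟨ ℤₚ.[+m]-[+n]≡m⊖n (S ℕ.∸ suc m) S ⟩
    (S ℕ.∸ suc m) ℤ.⊖ S           ≡⟨ ℤₚ.⊖-≤ (ℕₚ.m∸n≤m S (suc m)) ⟩
    ℤ.- + (S ℕ.∸ (S ℕ.∸ suc m))   ≡⟨ cong (λ k → ℤ.- + k) (ℕₚ.m∸[m∸n]≡n m<S) ⟩
    -[1+ m ]                      ∎
    where open ≡-Reasoning

levels-sorted : ∀ {n} (a : Vec ℕ n) → AllPairs ℤ._<_ (levels a)
levels-sorted a =
  AllPairs.map⁺ (AllPairs.applyUpTo⁺₁ id _ (λ i<j _ → ℤₚ.+-monoˡ-< (ℤ.- + sumV a) (ℤ.+<+ i<j)))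

range1-sorted : ∀ m → AllPairs ℕ._<_ (range1 m)
range1-sorted m = AllPairs.map⁺ (AllPairs.applyUpTo⁺₁ id m (λ i<j _ → s≤s i<j))

reverse-range1-sorted : ∀ m → AllPairs (λ j k → k ℕ.< j) (List.reverse (range1 m))
reverse-range1-sorted m
  rewrite sym (Listₚ.reverse-map suc (List.upTo m)) | Listₚ.reverse-upTo m =
  AllPairs.map⁺ (AllPairs.applyDownFrom⁺₁ id m (λ j<i _ → s≤s j<i))

InP⇒∈range1 : ∀ {n} {a x : Vec ℕ n} → InP a x → ∀ γ → lookup x γ ∈ range1 (lookup a γ)
InP⇒∈range1 ((s≤s {n = i} z≤n , i<a) ∷ _)    fzero    = ∈-map⁺ suc (∈-upTo⁺ i<a)
InP⇒∈range1 (_                       ∷ xs∈P) (fsuc γ) = InP⇒∈range1 xs∈P γ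

-- Pro_v and the layered product

module Layering {n} (a : Vec ℕ n) (v : Vec Sign n) (γ : Fin n) where

  open Buckets {Pt n} ℤ._≟_
  private module ByLayer = Buckets {Pt n} ℕ._≟_

  rank : Pt n → ℤ
  rank x = ⟨ x , v ⟩

  rank* : Pt n → ℤ
  rank* x = ⟨ del x γ , del v γ ⟩

  -- x ◁ y: x and y are adjacent, and Pro_v toggles x before y.
  _◁_ : Pt n → Pt n → Set
  x ◁ y = Adjacent x y × rank y ℤ.< rank x

  orient : ∀ {x y} → Adjacent x y → x ◁ y ⊎ y ◁ x
  orient adj = [ orient⋖ adj , swap ∘′ orient⋖ (swap adj) ]′ adj
    where
    orient⋖ : ∀ {p q} → Adjacent p q → p ⋖ q → p ◁ q ⊎ q ◁ p
    orient⋖ {p} {q} adj (i , c) with ◃1-step (lookup v i) (rank p)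
    ... | inj₁ p<q = inj₂ (swap adj , subst (rank p ℤ.<_) (sym (⟨⟩-⋖ v c)) p<q)
    ... | inj₂ q<p = inj₁ (adj , subst (ℤ._< rank p) (sym (⟨⟩-⋖ v c)) q<p)

  open Reordering a _◁_ orient

  proSeq : List (Pt n)
  proSeq = revConcatMap (bucket (λ _ → true) rank (elemsP a)) (levels a)

  layerSeq : ℕ → List (Pt n)
  layerSeq j = revConcatMap (bucket (λ x → lookup x γ ℕ.≡ᵇ j) rank* (elemsP a)) (levels a)

  Pro-toggleAll : ∀ I → Pro a v I ≡ toggleAll a proSeq I
  Pro-toggleAll = composeL-toggleAll a (bucket (λ _ → true) rank (elemsP a)) (levels a)

  Tlayers-toggleAll : ∀ js I → composeL (Tlayer a v γ) js I ≡ toggleAll a (revConcatMap layerSeq js) I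
  Tlayers-toggleAll js I =
    trans (composeL-cong (λ j → composeL-toggleAll a (bucket (λ x → lookup x γ ℕ.≡ᵇ j) rank* (elemsP a)) (levels a))
                         js I)
          (composeL-toggleAll a layerSeq js I)

  levels-unique : Unique (levels a)
  levels-unique = AllPairs.map (λ i<j i≡j → ℤₚ.<-irrefl i≡j i<j) (levels-sorted a)

  ⟨⟩∈levels : ∀ {m x} (w : Vec Sign m) (y : Pt m) → x ∈ elemsP a → sumV y ℕ.≤ sumV x →
    ⟨ y , w ⟩ ∈ levels a
  ⟨⟩∈levels w y x∈ y≤x =
    ∣∣≤⇒∈levels a ⟨ y , w ⟩
      (ℕₚ.≤-trans (∣⟨⟩∣≤sumV y w) (ℕₚ.≤-trans y≤x (InP⇒sumV≤ (∈elemsP⇒InP a x∈))))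

  proSeq-↭ : proSeq ↭ elemsP a
  proSeq-↭ = subst (proSeq ↭_) (filterᵇ-true (elemsP a))
    (revConcatMap-bucket-↭ (λ _ → true) rank (elemsP a) levels-unique
      (λ {x} x∈ _ → ⟨⟩∈levels v x x∈ ℕₚ.≤-refl))

  inLayer : ℕ → List (Pt n)
  inLayer = ByLayer.bucket (λ _ → true) (λ x → lookup x γ) (elemsP a)

  layer-↭ : ∀ j → layerSeq j ↭ inLayer j
  layer-↭ j = revConcatMap-bucket-↭ (λ x → lookup x γ ℕ.≡ᵇ j) rank* (elemsP a) levels-unique
    (λ {x} x∈ _ → ⟨⟩∈levels (del v γ) (del x γ) x∈ (sumV-del x γ))

  layers-↭ : ∀ {js} → Unique js → (∀ {x} → x ∈ elemsP a → lookup x γ ∈ js) →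
    revConcatMap layerSeq js ↭ elemsP a
  layers-↭ {js} uniq caught = ↭-trans (revConcatMap-↭ layer-↭ js)
    (subst (revConcatMap inLayer js ↭_) (filterᵇ-true (elemsP a))
      (ByLayer.revConcatMap-bucket-↭ (λ _ → true) (λ x → lookup x γ) (elemsP a) uniq (λ x∈ _ → caught x∈)))

  proSeq-respects : Respects proSeq
  proSeq-respects = AllPairs.map (λ ry≤rx y◁x → ℤₚ.≤⇒≯ ry≤rx (proj₂ y◁x))
    (revConcatMap-bucket-sorted (λ _ → true) rank (elemsP a) (levels-sorted a))

  ∈layer⇒lookup : ∀ {j x} → x ∈ layerSeq j → lookup x γ ≡ j
  ∈layer⇒lookup {j} {x} x∈ with ∈-revConcatMap⁻ _ (levels a) x∈
  ... | _ , _ , x∈k =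
    ℕₚ.≡ᵇ⇒≡ _ j (Equivalence.from T-≡ (proj₁ (proj₂ (∈-bucket⁻ _ rank* (elemsP a) x∈k))))

  layer-respects : ∀ j → Respects (layerSeq j)
  layer-respects j = AllPairs.zipWith
    (λ (r*y≤r*x , same) y◁x → ℤₚ.≤⇒≯ (rank-monotone same r*y≤r*x) (proj₂ y◁x))
    (revConcatMap-bucket-sorted (λ x → lookup x γ ℕ.≡ᵇ j) rank* (elemsP a) (levels-sorted a) ,
     AllPairs-tabulate (layerSeq j) (λ x∈ y∈ → trans (∈layer⇒lookup x∈) (sym (∈layer⇒lookup y∈))))
    where
    rank-monotone : ∀ {x y} → lookup x γ ≡ lookup y γ → rank* y ℤ.≤ rank* x → rank y ℤ.≤ rank x
    rank-monotone {x} {y} same r*y≤r*x =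
      subst₂ ℤ._≤_ (sym (⟨⟩-del y v γ)) (sym (⟨⟩-del x v γ))
        (subst (λ k → (lookup v γ ◃ k) ℤ.+ rank* y ℤ.≤ (lookup v γ ◃ lookup x γ) ℤ.+ rank* x) same
          (ℤₚ.+-monoʳ-≤ (lookup v γ ◃ lookup x γ) r*y≤r*x))

  layers-respects : ∀ {S : ℕ → ℕ → Set} {js} → AllPairs S js →
    (∀ {x y} → S (lookup y γ) (lookup x γ) → ¬ y ◁ x) → Respects (revConcatMap layerSeq js)
  layers-respects {S} sorted across = revConcatMap-AllPairs layerSeq sorted layer-respects
    (λ S-j-j′ x∈ y∈ → across (subst₂ S (sym (∈layer⇒lookup y∈)) (sym (∈layer⇒lookup x∈)) S-j-j′))

  cross-layer : ∀ {x y} → x ⋖ y → lookup x γ ≢ lookup y γ →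
    lookup y γ ≡ suc (lookup x γ) × rank y ≡ (lookup v γ ◃ 1) ℤ.+ rank x
  cross-layer (i , c) x≢y with ⋖-lookup c γ
  ... | inj₁ (refl , up) = up , ⟨⟩-⋖ v c
  ... | inj₂ same        = ⊥-elim (x≢y (sym same))

  upward-layers : lookup v γ ≡ Sign.+ → ∀ {x y} → lookup y γ ℕ.< lookup x γ → ¬ y ◁ x
  upward-layers v+ y<x (inj₁ y⋖x , rx<ry) with cross-layer y⋖x (ℕₚ.<⇒≢ y<x)
  ... | _ , rx≡ rewrite v+ = ℤₚ.<-asym rx<ry (subst (rank _ ℤ.<_) (sym rx≡) (+1-step (rank _)))
  upward-layers v+ {x} y<x (inj₂ x⋖y , _) with cross-layer x⋖y (ℕₚ.<⇒≢ y<x ∘′ sym)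
  ... | up , _ = ℕₚ.<-asym y<x (subst (lookup x γ ℕ.<_) (sym up) (ℕₚ.n<1+n _))

  downward-layers : lookup v γ ≡ Sign.- → ∀ {x y} → lookup x γ ℕ.< lookup y γ → ¬ y ◁ x
  downward-layers v- {y = y} x<y (inj₁ y⋖x , _) with cross-layer y⋖x (ℕₚ.<⇒≢ x<y ∘′ sym)
  ... | up , _ = ℕₚ.<-asym x<y (subst (lookup y γ ℕ.<_) (sym up) (ℕₚ.n<1+n _))
  downward-layers v- x<y (inj₂ x⋖y , rx<ry) with cross-layer x⋖y (ℕₚ.<⇒≢ x<y)
  ... | _ , ry≡ rewrite v- = ℤₚ.<-asym rx<ry (subst (ℤ._< rank _) (sym ry≡) (-1-step (rank _)))

  Pro≗Tlayers : ∀ {js} → Unique js → (∀ {x} → x ∈ elemsP a → lookup x γ ∈ js) →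
    Respects (revConcatMap layerSeq js) → ∀ {I} → isIdeal a I ≡ true → Pro a v I ≗ composeL (Tlayer a v γ) js I
  Pro≗Tlayers {js} uniq caught respLayers {I} hI z = begin
    Pro a v I z                              ≡⟨ cong (λ J → J z) (Pro-toggleAll I) ⟩
    toggleAll a proSeq I z                   ≡⟨ toggleAll-reorder (revConcatMap layerSeq js)
                                                  (↭-trans proSeq-↭ (↭-sym (layers-↭ uniq caught)))
                                                  proSeq∈P proSeq-respects respLayers hI z ⟩
    toggleAll a (revConcatMap layerSeq js) I z  ≡⟨ cong (λ J → J z) (Tlayers-toggleAll js I) ⟨
    composeL (Tlayer a v γ) js I z           ∎
    where
    open ≡-Reasoning
    proSeq∈P : All (InP a) proSeq
    proSeq∈P = All.tabulate (λ x∈ → ∈elemsP⇒InP a (∈-resp-↭ proSeq-↭ x∈))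

-- The equality holds at every point x.
theorem4p3 : (n : ℕ) (a : Vec ℕ n) (v : Vec Sign n) (γ : Fin n) (I : Sub n) →
    isIdeal a I ≡ true → (x : Pt n) → inPᵇ a x ≡ true →
    (lookup v γ ≡ Sign.+ →
      Pro a v I x ≡ composeL (Tlayer a v γ) (range1 (lookup a γ)) I x)
    × (lookup v γ ≡ Sign.- →
      Pro a v I x ≡ composeL (Tlayer a v γ) (reverse (range1 (lookup a γ))) I x)
theorem4p3 n a v γ I hI x _ =
  (λ v+ → Pro≗Tlayers (AllPairs.map ℕₚ.<⇒≢ ascending) caught
                      (layers-respects ascending (upward-layers v+)) hI x) ,
  (λ v- → Pro≗Tlayers (AllPairs.map (λ k<j → ℕₚ.<⇒≢ k<j ∘′ sym) descending)
                      (Any.reverse⁺ ∘′ caught)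
                      (layers-respects descending (downward-layers v-)) hI x)
  where
  open Layering a v γ
  ascending : AllPairs ℕ._<_ (range1 (lookup a γ))
  ascending = range1-sorted (lookup a γ)
  descending : AllPairs (λ j k → k ℕ.< j) (reverse (range1 (lookup a γ)))
  descending = reverse-range1-sorted (lookup a γ)
  caught : ∀ {y} → y ∈ elemsP a → lookup y γ ∈ range1 (lookup a γ)
  caught y∈ = InP⇒∈range1 (∈elemsP⇒InP a y∈) γ
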